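{- Let $n=2^k$ with $k\ge 2$ an integer. With $T(n)$, $\widehat{T}(n)$, $\widehat{\widehat{T}}(n)$ the numbers of literals in the expressions produced by the one-vertex decomposition algorithm (1-VDA) for a square rhomboid of size $n$, a single-leaf square rhomboid of size $n$, and a dipterous square rhomboid of size $n$ respectively, $$T(n)=\tfrac{154}{135}n^{\log_2 6}+\tfrac{1}{27}n^{\log_2 3}-\tfrac{2}{5},\qquad \widehat{T}(n)=\tfrac{154}{135}n^{\log_2 6}+\tfrac{19}{27}n^{\log_2 3}-\tfrac{2}{5},\qquad \widehat{\widehat{T}}(n)=\tfrac{154}{135}n^{\log_2 6}+\tfrac{58}{27}n^{\log_2 3}-\tfrac{2}{5}.$$
   Context: Square rhomboid. For an integer $n\ge 1$, the square rhomboid $SR(n)$ is the directed acyclic graph with basic vertices $1,\dots,n$, upper vertices $\overline{1},\dots,\overline{n-1}$ and lower vertices $\underline{1},\dots,\underline{n-1}$, and the following labeled edges (all labels are distinct literals): for $1\le v\le n-1$: $b_v:v\to v+1$, $e_{2v-1}:v\to\overline{v}$, $e_{2v}:\overline{v}\to v+1$, $d_{2v-1}:v\to\underline{v}$, $d_{2v}:\underline{v}\to v+1$; for $1\le v\le n-2$: $c_v:\overline{v}\to\overline{v+1}$ and $a_v:\underline{v}\to\underline{v+1}$. For vertices $x,y$ of a sufficiently large square rhomboid, the subgraph from $x$ to $y$ consists of all vertices and edges lying on directed paths from $x$ to $y$; its canonical expression is the sum, over all directed $x$–$y$ paths, of the product of the edge labels along the path. An expression of this subgraph is any expression built from the literals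 with $+$ and $\cdot$ that is algebraically equivalent to the canonical expression; its complexity is its total number of literal occurrences. Kinds of subgraphs: the subgraph from $p$ to $q$ ($p\le q$) is a square rhomboid of size $q-p+1$. The subgraphs from $p$ to $\overline{q}$ or to $\underline{q}$ ($p\le q$) are single-leaf square rhomboids of size $q-p+1$; those from $\overline{p}$ or $\underline{p}$ to $q$ ($p<q$) are single-leaf square rhomboids of size $q-p$. The subgraphs from $\overline{p}$ to $\overline{q}$ and from $\underline{p}$ to $\underline{q}$ ($p<q$) are trapezoidal dipterous square rhomboids of size $q-p$; those from $\underline{p}$ to $\overline{q}$ and from $\overline{p}$ to $\underline{q}$ ($p<q$) are parallelogram dipterous square rhomboids of size $q-p$. 1-VDA defines a formal expression $E(x,y)$ for each such subgraph by the rules: 1. $E(p,p)=1$; 2. $E(p,\overline{p})=e_{2p-1}$; 3. $E(p,\underline{p})=d_{2p-1}$; 4. $E(\overline{p},p+1)=e_{2p}$; 5. $E(\underline{p},p+1)=d_{2p}$; 6. $E(\overline{p},\overline{p+1})=c_p+e_{2p}e_{2p+1}$; 7. $E(\overline{p},\underline{p+1})=e_{2p}d_{2p+1}$; 8. $E(\underline{p},\overline{p+1})=d_{2p}e_{2p+1}$; 9. $E(\underline{p},\underline{p+1})=a_p+d_{2p}d_{2p+1}$; 10. $E(p,p+1)=b_p+e_{2p-1}e_{2p}+d_{2p-1}d_{2p}$; 11. $E(p,\overline{p+1})=(b_p+d_{2p-1}d_{2p})e_{2p+1}+e_{2p-1}(c_p+e_{2p}e_{2p+1})$; 12. $E(p,\underline{p+1})=(b_p+e_{2p-1}e_{2p})d_{2p+1}+d_{2p-1}(a_p+d_{2p}d_{2p+1})$;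 13. $E(\overline{p},p+2)=(c_p+e_{2p}e_{2p+1})e_{2p+2}+e_{2p}(b_{p+1}+d_{2p+1}d_{2p+2})$; 14. $E(\underline{p},p+2)=(a_p+d_{2p}d_{2p+1})d_{2p+2}+d_{2p}(b_{p+1}+e_{2p+1}e_{2p+2})$; 15. $E(\overline{p},\overline{p+2})=e_{2p}(b_{p+1}+d_{2p+1}d_{2p+2})e_{2p+3}+(a_p+d_{2p}d_{2p+1})(a_{p+1}+d_{2p+2}d_{2p+3})$; 16. $E(\overline{p},\underline{p+2})=e_{2p}(b_{p+1}d_{2p+3}+d_{2p+1}(a_{p+1}+d_{2p+2}d_{2p+3}))+(c_p+e_{2p}e_{2p+1})e_{2p+2}d_{2p+3}$; 17. $E(\underline{p},\overline{p+2})=d_{2p}(b_{p+1}e_{2p+3}+e_{2p+1}(c_{p+1}+e_{2p+2}e_{2p+3}))+(a_p+d_{2p}d_{2p+1})d_{2p+2}e_{2p+3}$; 18. $E(\underline{p},\underline{p+2})=d_{2p}(b_{p+1}+e_{2p+1}e_{2p+2})d_{2p+3}+(c_p+e_{2p}e_{2p+1})(c_{p+1}+e_{2p+2}e_{2p+3})$. Otherwise, writing $x\in\{p,\overline{p},\underline{p}\}$ and $y\in\{q,\overline{q},\underline{q}\}$, $E(x,y)=E(x,i)E(i,y)+E(x,\overline{i-1})\,c_{i-1}\,E(\overline{i},y)+E(x,\underline{i-1})\,a_{i-1}\,E(\underline{i},y)$, where: for $x=p$, $y\in\{\overline{q},\underline{q}\}$, $q>p+1$: $i=\lceil (q+p)/2\rceil$;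 for $x\in\{\overline{p},\underline{p}\}$, $y=q$, $q>p+2$: $i=\lceil (q+p)/2\rceil$; for $x\in\{\overline{p},\underline{p}\}$, $y\in\{\overline{q},\underline{q}\}$, $q>p+2$: $i=(q+p+1)/2$ (rounded up or down when not an integer); for $x=p$, $y=q$, $q>p+1$: $i=(q+p)/2$ (rounded up or down when not an integer). The number of literals of the 1-VDA expression of a subgraph depends only on its kind and size, and for sizes $n>2$ the trapezoidal and parallelogram dipterous counts coincide; $T(n)$ is the number of literals of $E(1,n)$. -}

module Defs where

open import Data.Nat using (ℕ; zero; suc; _+_; _*_; _∸_; _≤_; ⌊_/2⌋; ⌈_/2⌉)
open import Data.Bool using (Bool; true; false; if_then_else_)
open import Data.List using (List; []; _∷_)

-- Vertices of a (sufficiently large) square rhomboid: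
-- bas p = p, up p = overline p, lo p = underline p.
data Vertex : Set where
  bas up lo : ℕ → Vertex

idx : Vertex → ℕ
idx (bas p) = p
idx (up p)  = p
idx (lo p)  = p

data Lit : Set where
  a b c d e : ℕ → Lit

data Expr : Set where
  one  : Expr
  lit  : Lit → Expr
  _⊕_ : Expr → Expr → Expr
  _⊗_ : Expr → Expr → Expr

infixl 6 _⊕_
infixl 7 _⊗_

lits : Expr → ℕ
lits one       = 0
lits (lit _)   = 1
lits (x ⊕ y)   = lits x + lits y
lits (x ⊗ y)   = lits x + lits y

A B C D E' : ℕ → Expr
A n = lit (a n)
B n = lit (b n)
C n = lit (c n)
D n = lit (d n)
E' n = lit (e n)

-- Rounding oracle: at each recursive step where the split vertex i is
-- "(…)/2 rounded up or down", the choice may be made arbitrarily; the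
-- oracle receives the position in the recursion tree (list of branch
-- indices) and the current pair of endpoints; true = round up.
Oracle : Set
Oracle = List ℕ → Vertex → Vertex → Bool

half : Bool → ℕ → ℕ
half r s = if r then ⌈ s /2⌉ else ⌊ s /2⌋

-- The 1-VDA expression E(x,y), with a fuel argument ensuring termination
-- (fuel idx y + 3 is always sufficient: each recursive call strictly
-- shrinks idx y - idx x).  Ill-formed pairs return 1 (never reached).
vda : ℕ → Oracle → List ℕ → Vertex → Vertex → Expr
vda zero ρ π x y = one
vda (suc f) ρ π x y = go x y
  where
  split : ℕ → Expr
  split i =
    vda f ρ (0 ∷ π) x (bas i) ⊗ vda f ρ (1 ∷ π) (bas i) y
    ⊕ vda f ρ (2 ∷ π) x (up (i ∸ 1)) ⊗ C (i ∸ 1) ⊗ vda f ρ (3 ∷ π) (up i) y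
    ⊕ vda f ρ (4 ∷ π) x (lo (i ∸ 1)) ⊗ A (i ∸ 1) ⊗ vda f ρ (5 ∷ π) (lo i) y

  r : Bool
  r = ρ π x y

  go : Vertex → Vertex → Expr
  go (bas p) (bas q) with q ∸ p
  ... | zero = one
  ... | suc zero = B p ⊕ E' (2 * p ∸ 1) ⊗ E' (2 * p) ⊕ D (2 * p ∸ 1) ⊗ D (2 * p)
  ... | suc (suc _) = split (half r (p + q))
  go (bas p) (up q) with q ∸ p
  ... | zero = E' (2 * p ∸ 1)
  ... | suc zero = (B p ⊕ D (2 * p ∸ 1) ⊗ D (2 * p)) ⊗ E' (2 * p + 1)
                   ⊕ E' (2 * p ∸ 1) ⊗ (C p ⊕ E' (2 * p) ⊗ E' (2 * p + 1))
  ... | suc (suc _) = split ⌈ p + q /2⌉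
  go (bas p) (lo q) with q ∸ p
  ... | zero = D (2 * p ∸ 1)
  ... | suc zero = (B p ⊕ E' (2 * p ∸ 1) ⊗ E' (2 * p)) ⊗ D (2 * p + 1)
                   ⊕ D (2 * p ∸ 1) ⊗ (A p ⊕ D (2 * p) ⊗ D (2 * p + 1))
  ... | suc (suc _) = split ⌈ p + q /2⌉
  go (up p) (bas q) with q ∸ p
  ... | zero = one
  ... | suc zero = E' (2 * p)
  ... | suc (suc zero) = (C p ⊕ E' (2 * p) ⊗ E' (2 * p + 1)) ⊗ E' (2 * p + 2)
                         ⊕ E' (2 * p) ⊗ (B (p + 1) ⊕ D (2 * p + 1) ⊗ D (2 * p + 2))
  ... | suc (suc (suc _)) = split ⌈ p + q /2⌉
  go (lo p) (bas q) with q ∸ p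
  ... | zero = one
  ... | suc zero = D (2 * p)
  ... | suc (suc zero) = (A p ⊕ D (2 * p) ⊗ D (2 * p + 1)) ⊗ D (2 * p + 2)
                         ⊕ D (2 * p) ⊗ (B (p + 1) ⊕ E' (2 * p + 1) ⊗ E' (2 * p + 2))
  ... | suc (suc (suc _)) = split ⌈ p + q /2⌉
  go (up p) (up q) with q ∸ p
  ... | zero = one
  ... | suc zero = C p ⊕ E' (2 * p) ⊗ E' (2 * p + 1)
  ... | suc (suc zero) =
        E' (2 * p) ⊗ (B (p + 1) ⊕ D (2 * p + 1) ⊗ D (2 * p + 2)) ⊗ E' (2 * p + 3)
        ⊕ (C p ⊕ E' (2 * p) ⊗ E' (2 * p + 1)) ⊗ (C (p + 1) ⊕ E' (2 * p + 2) ⊗ E' (2 * p + 3))  -- rule 15 (corrected)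
  ... | suc (suc (suc _)) = split (half r (p + q + 1))
  go (up p) (lo q) with q ∸ p
  ... | zero = one
  ... | suc zero = E' (2 * p) ⊗ D (2 * p + 1)
  ... | suc (suc zero) =
        E' (2 * p) ⊗ (B (p + 1) ⊗ D (2 * p + 3) ⊕ D (2 * p + 1) ⊗ (A (p + 1) ⊕ D (2 * p + 2) ⊗ D (2 * p + 3)))
        ⊕ (C p ⊕ E' (2 * p) ⊗ E' (2 * p + 1)) ⊗ E' (2 * p + 2) ⊗ D (2 * p + 3)
  ... | suc (suc (suc _)) = split (half r (p + q + 1))
  go (lo p) (up q) with q ∸ p
  ... | zero = one
  ... | suc zero = D (2 * p) ⊗ E' (2 * p + 1)
  ... | suc (suc zero) =
        D (2 * p) ⊗ (B (p + 1) ⊗ E' (2 * p + 3) ⊕ E' (2 * p + 1) ⊗ (C (p + 1) ⊕ E' (2 * p + 2) ⊗ E' (2 * p + 3)))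
        ⊕ (A p ⊕ D (2 * p) ⊗ D (2 * p + 1)) ⊗ D (2 * p + 2) ⊗ E' (2 * p + 3)
  ... | suc (suc (suc _)) = split (half r (p + q + 1))
  go (lo p) (lo q) with q ∸ p
  ... | zero = one
  ... | suc zero = A p ⊕ D (2 * p) ⊗ D (2 * p + 1)
  ... | suc (suc zero) =
        D (2 * p) ⊗ (B (p + 1) ⊕ E' (2 * p + 1) ⊗ E' (2 * p + 2)) ⊗ D (2 * p + 3)
        ⊕ (A p ⊕ D (2 * p) ⊗ D (2 * p + 1)) ⊗ (A (p + 1) ⊕ D (2 * p + 2) ⊗ D (2 * p + 3))  -- rule 18 (corrected)
  ... | suc (suc (suc _)) = split (half r (p + q + 1))

VDA : Oracle → Vertex → Vertex → Expr
VDA ρ x y = vda (idx y + 3) ρ [] x y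

data SingleLeaf (n : ℕ) : Vertex → Vertex → Set where
  bas→up : ∀ p → 1 ≤ p → SingleLeaf n (bas p) (up (p + n ∸ 1))
  bas→lo : ∀ p → 1 ≤ p → SingleLeaf n (bas p) (lo (p + n ∸ 1))
  up→bas : ∀ p → 1 ≤ p → SingleLeaf n (up p) (bas (p + n))
  lo→bas : ∀ p → 1 ≤ p → SingleLeaf n (lo p) (bas (p + n))

data Dipterous (n : ℕ) : Vertex → Vertex → Set where
  up→up : ∀ p → 1 ≤ p → Dipterous n (up p) (up (p + n))
  lo→lo : ∀ p → 1 ≤ p → Dipterous n (lo p) (lo (p + n))
  up→lo : ∀ p → 1 ≤ p → Dipterous n (up p) (lo (p + n))
  lo→up : ∀ p → 1 ≤ p → Dipterous n (lo p) (up (p + n))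

module Submission where

-- Write n = h + 2.  Every subgraph met by the recursion is described by a class
-- (Tag): the kinds of its end vertices and its size n − 1, n or n + 1 (Member).
-- The first part computes what vda does: its unfolding by the general rule and
-- the position of the split vertex, which show (decompose) that a member of
-- size 2n splits into six members of size n, the classes involved being given
-- by the recurrences of the datatype Rule.  The second part is the counting
-- invariant Level: every member of class t has 135ℓ + 54 + 280Q = P + κ(t)Q
-- literals ℓ, where P = 154·6^k, Q = 3^k.  By split-count it passes from size n
-- to 2n whenever the coefficients obey the linear recurrence (step).  At n = 2
-- all literal counts are computed outright (level₀); one step brings the
-- coefficients to a fixed point coeff of the recurrence, so by induction the
-- invariant holds for all n = 2^k, k ≥ 2, and the theorem reads it off for the
-- classes of size exactly n.

open import Defs
open import Data.Nat using (ℕ; zero; suc; _+_; _*_; _^_; _≤_; _<_; _∸_; ⌊_/2⌋; ⌈_/2⌉; s≤s; z≤n)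
open import Data.Nat.Properties
  using (+-suc; +-assoc; +-cancelʳ-≡; m+n∸m≡n; n≡⌊n+n/2⌋; n≡⌈n+n/2⌉;
         ≤-trans; ≤-pred; <-≤-trans; n≤1+n; m≤m+n; m≤n+m; +-monoˡ-≤; +-monoˡ-<)
open import Data.Nat.Tactic.RingSolver using (solve-∀)
open import Data.Bool using (true; false)
open import Data.List using (List; _∷_; [])
open import Data.Product using (_×_; _,_)
open import Data.Sum using (_⊎_; inj₁; inj₂)
open import Relation.Binary.PropositionalEquality
  using (_≡_; refl; sym; trans; cong; cong₂; subst; module ≡-Reasoning)
open ≡-Reasoning

data Side : Set where
  U L : Side

side : Side → ℕ → Vertex
side U = up
side L = lo

-- Classes of subgraphs relative to a reference size n: a square rhomboid (sq),
-- a single-leaf one with the leaf at the end (sle, p → q̄/q̲) or at the start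
-- (sls, p̄/p̲ → q), or a dipterous one (dip); the index gives the size n − 1,
-- n or n + 1.
data Tag : Set where
  sq₀ sq₊        : Tag
  sle₋ sle₀ sle₊ : Side → Tag
  sls₋ sls₀ sls₊ : Side → Tag
  dip₋ dip₀      : Side → Side → Tag

source : Tag → ℕ → Vertex
source (sls₋ v)   = side v
source (sls₀ v)   = side v
source (sls₊ v)   = side v
source (dip₋ v _) = side v
source (dip₀ v _) = side v
source _          = bas

target : Tag → ℕ → Vertex
target (sle₋ w)   = side w
target (sle₀ w)   = side w
target (sle₊ w)   = side w
target (dip₋ _ w) = side w
target (dip₀ _ w) = side w
target _          = bas

-- At reference size n = h + 2 a subgraph of class t spans the indices
-- p, …, p + gap t + h.
gap : Tag → ℕ
gap sq₀        = 1
gap sq₊        = 2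
gap (sle₋ _)   = 0
gap (sle₀ _)   = 1
gap (sle₊ _)   = 2
gap (sls₋ _)   = 1
gap (sls₀ _)   = 2
gap (sls₊ _)   = 3
gap (dip₋ _ _) = 1
gap (dip₀ _ _) = 2

-- Member h t x y: the subgraph from x to y belongs to class t at size h + 2.
data Member (h : ℕ) (t : Tag) : Vertex → Vertex → Set where
  member : ∀ p {q} → q ≡ p + (gap t + h) → Member h t (source t p) (target t q)

idx-side : ∀ s q → idx (side s q) ≡ q
idx-side U q = refl
idx-side L q = refl

idx-target : ∀ t q → idx (target t q) ≡ q
idx-target (sle₋ w)   = idx-side w
idx-target (sle₀ w)   = idx-side w
idx-target (sle₊ w)   = idx-side w
idx-target (dip₋ _ w) = idx-side w
idx-target (dip₀ _ w) = idx-side w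
idx-target sq₀        = λ _ → refl
idx-target sq₊        = λ _ → refl
idx-target (sls₋ _)   = λ _ → refl
idx-target (sls₀ _)   = λ _ → refl
idx-target (sls₊ _)   = λ _ → refl

member-reach : ∀ {h t x y} → Member h t x y → 1 ≤ gap t → h < idx y
member-reach {h} {t} (member p {q} refl) pos =
  subst (h <_) (sym (idx-target t q)) (≤-trans (+-monoˡ-≤ h pos) (m≤n+m (gap t + h) p))

-- The expression produced by the general rule of 1-VDA when x → y is split at
-- the basic vertex i (the local definition "split" inside vda).
splitExpr : ℕ → Oracle → List ℕ → Vertex → Vertex → ℕ → Expr
splitExpr f ρ π x y i =
    vda f ρ (0 ∷ π) x (bas i) ⊗ vda f ρ (1 ∷ π) (bas i) y
    ⊕ vda f ρ (2 ∷ π) x (up (i ∸ 1)) ⊗ C (i ∸ 1) ⊗ vda f ρ (3 ∷ π) (up i) y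
    ⊕ vda f ρ (4 ∷ π) x (lo (i ∸ 1)) ⊗ A (i ∸ 1) ⊗ vda f ρ (5 ∷ π) (lo i) y

unfold-sq : ∀ f ρ π p k {i} → let x = bas p ; y = bas (p + suc (suc k)) in
  half (ρ π x y) (p + (p + suc (suc k))) ≡ i →
  vda (suc f) ρ π x y ≡ splitExpr f ρ π x y i
unfold-sq f ρ π p k mid rewrite m+n∸m≡n p (suc (suc k)) = cong (splitExpr f ρ π _ _) mid

unfold-sle : ∀ f ρ π p k w {i} → let x = bas p ; y = side w (p + suc (suc k)) in
  ⌈ p + (p + suc (suc k)) /2⌉ ≡ i → vda (suc f) ρ π x y ≡ splitExpr f ρ π x y i
unfold-sle f ρ π p k U mid rewrite m+n∸m≡n p (suc (suc k)) = cong (splitExpr f ρ π _ _) mid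
unfold-sle f ρ π p k L mid rewrite m+n∸m≡n p (suc (suc k)) = cong (splitExpr f ρ π _ _) mid

unfold-sls : ∀ f ρ π p k v {i} → let x = side v p ; y = bas (p + suc (suc (suc k))) in
  ⌈ p + (p + suc (suc (suc k))) /2⌉ ≡ i → vda (suc f) ρ π x y ≡ splitExpr f ρ π x y i
unfold-sls f ρ π p k U mid rewrite m+n∸m≡n p (suc (suc (suc k))) = cong (splitExpr f ρ π _ _) mid
unfold-sls f ρ π p k L mid rewrite m+n∸m≡n p (suc (suc (suc k))) = cong (splitExpr f ρ π _ _) mid

unfold-dip : ∀ f ρ π p k v w {i} → let x = side v p ; y = side w (p + suc (suc (suc k))) in
  half (ρ π x y) (p + (p + suc (suc (suc k))) + 1) ≡ i →
  vda (suc f) ρ π x y ≡ splitExpr f ρ π x y i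
unfold-dip f ρ π p k U U mid rewrite m+n∸m≡n p (suc (suc (suc k))) = cong (splitExpr f ρ π _ _) mid
unfold-dip f ρ π p k U L mid rewrite m+n∸m≡n p (suc (suc (suc k))) = cong (splitExpr f ρ π _ _) mid
unfold-dip f ρ π p k L U mid rewrite m+n∸m≡n p (suc (suc (suc k))) = cong (splitExpr f ρ π _ _) mid
unfold-dip f ρ π p k L L mid rewrite m+n∸m≡n p (suc (suc (suc k))) = cong (splitExpr f ρ π _ _) mid

-- Arithmetic of the split vertex.  The reference size doubles from h + 2 to
-- double h + 2.
double : ℕ → ℕ
double h = suc (suc (h + h))

doubling : ∀ h o₀ o₁ {o} → o₀ + o₁ ≡ 2 + o → (o₀ + h) + (o₁ + h) ≡ o + double h
doubling h o₀ o₁ {o} sum = begin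
  (o₀ + h) + (o₁ + h)  ≡⟨ regroup o₀ o₁ h ⟩
  (o₀ + o₁) + (h + h)  ≡⟨ cong (_+ (h + h)) sum ⟩
  (2 + o) + (h + h)    ≡⟨ shift o h ⟩
  o + double h         ∎
  where
  regroup : ∀ m n h → (m + h) + (n + h) ≡ (m + n) + (h + h)
  regroup = solve-∀
  shift : ∀ o h → (2 + o) + (h + h) ≡ o + (2 + (h + h))
  shift = solve-∀

beyond : ∀ p {m n k} → m + n ≡ k → p + k ≡ (p + m) + n
beyond p {m} {n} sum = trans (cong (p +_) (sym sum)) (sym (+-assoc p m n))

before : ∀ p m → p + suc m ∸ 1 ≡ p + m
before p m = cong (_∸ 1) (+-suc p m)

endpoints : ∀ p m n → p + (p + (m + n)) ≡ (p + m) + (p + n)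
endpoints = solve-∀

mid-even : ∀ r p m {k} → m + m ≡ k → half r (p + (p + k)) ≡ p + m
mid-even r p m refl = trans (cong (half r) (endpoints p m m)) (halve r (p + m))
  where
  halve : ∀ r n → half r (n + n) ≡ n
  halve true  n = sym (n≡⌈n+n/2⌉ n)
  halve false n = sym (n≡⌊n+n/2⌋ n)

odd-endpoints : ∀ p m → p + (p + (m + suc m)) ≡ suc ((p + m) + (p + m))
odd-endpoints = solve-∀

mid-odd-up : ∀ p m {k} → m + suc m ≡ k → ⌈ p + (p + k) /2⌉ ≡ p + suc m
mid-odd-up p m refl = begin
  ⌈ p + (p + (m + suc m)) /2⌉  ≡⟨ cong ⌈_/2⌉ (odd-endpoints p m) ⟩
  suc ⌊ (p + m) + (p + m) /2⌋   ≡⟨ cong suc (sym (n≡⌊n+n/2⌋ (p + m))) ⟩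
  suc (p + m)                   ≡⟨ sym (+-suc p m) ⟩
  p + suc m                     ∎

mid-odd : ∀ r p m {k} → m + suc m ≡ k →
  half r (p + (p + k)) ≡ p + m ⊎ half r (p + (p + k)) ≡ p + suc m
mid-odd true  p m sum  = inj₂ (mid-odd-up p m sum)
mid-odd false p m refl =
  inj₁ (trans (cong ⌊_/2⌋ (odd-endpoints p m)) (sym (n≡⌈n+n/2⌉ (p + m))))

-- For dipterous subgraphs 1-VDA halves p + q + 1.
plus-one : ∀ p k → p + (p + k) + 1 ≡ p + (p + suc k)
plus-one = solve-∀

record Split (h : ℕ) (t₀ t₁ t₂ t₃ t₄ t₅ : Tag)
             (f : ℕ) (ρ : Oracle) (π : List ℕ) (x y : Vertex) : Set where
  constructor split
  field
    {point} : ℕ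
    unfolds : vda (suc f) ρ π x y ≡ splitExpr f ρ π x y point
    piece₀  : Member h t₀ x (bas point)
    piece₁  : Member h t₁ (bas point) y
    piece₂  : Member h t₂ x (up (point ∸ 1))
    piece₃  : Member h t₃ (up point) y
    piece₄  : Member h t₄ x (lo (point ∸ 1))
    piece₅  : Member h t₅ (lo point) y

-- The recurrences of 1-VDA: a subgraph of class t at size 2n splits into pieces
-- of classes t₀ … t₅ at size n (for sq₀ and dip₀ depending on the rounding).
data Rule : Tag → Tag → Tag → Tag → Tag → Tag → Tag → Set where
  cut-sq₀↓ : Rule sq₀ sq₀ sq₊ (sle₋ U) (sls₀ U) (sle₋ L) (sls₀ L)
  cut-sq₀↑ : Rule sq₀ sq₊ sq₀ (sle₀ U) (sls₋ U) (sle₀ L) (sls₋ L)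
  cut-sq₊  : Rule sq₊ sq₊ sq₊ (sle₀ U) (sls₀ U) (sle₀ L) (sls₀ L)
  cut-sle₋ : ∀ w → Rule (sle₋ w) sq₀ (sle₀ w) (sle₋ U) (dip₋ U w) (sle₋ L) (dip₋ L w)
  cut-sle₀ : ∀ w → Rule (sle₀ w) sq₊ (sle₀ w) (sle₀ U) (dip₋ U w) (sle₀ L) (dip₋ L w)
  cut-sle₊ : ∀ w → Rule (sle₊ w) sq₊ (sle₊ w) (sle₀ U) (dip₀ U w) (sle₀ L) (dip₀ L w)
  cut-sls₋ : ∀ v → Rule (sls₋ v) (sls₀ v) sq₀ (dip₋ v U) (sls₋ U) (dip₋ v L) (sls₋ L)
  cut-sls₀ : ∀ v → Rule (sls₀ v) (sls₀ v) sq₊ (dip₋ v U) (sls₀ U) (dip₋ v L) (sls₀ L)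
  cut-sls₊ : ∀ v → Rule (sls₊ v) (sls₊ v) sq₊ (dip₀ v U) (sls₀ U) (dip₀ v L) (sls₀ L)
  cut-dip₋ : ∀ v w → Rule (dip₋ v w) (sls₀ v) (sle₀ w) (dip₋ v U) (dip₋ U w) (dip₋ v L) (dip₋ L w)
  cut-dip₀↓ : ∀ v w → Rule (dip₀ v w) (sls₀ v) (sle₊ w) (dip₋ v U) (dip₀ U w) (dip₋ v L) (dip₀ L w)
  cut-dip₀↑ : ∀ v w → Rule (dip₀ v w) (sls₊ v) (sle₀ w) (dip₀ v U) (dip₋ U w) (dip₀ v L) (dip₋ L w)

record Decomposition (h : ℕ) (t : Tag) (f : ℕ) (ρ : Oracle) (π : List ℕ) (x y : Vertex) : Set where
  constructor decomposition
  field
    {t₀ t₁ t₂ t₃ t₄ t₅} : Tag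
    rule  : Rule t t₀ t₁ t₂ t₃ t₄ t₅
    parts : Split h t₀ t₁ t₂ t₃ t₄ t₅ f ρ π x y

decompose : ∀ {h t x y} → Member (double h) t x y → ∀ f ρ π → Decomposition h t f ρ π x y
decompose {h} {sq₀} (member p refl) f ρ π
  with mid-odd (ρ π (bas p) (bas (p + (1 + double h)))) p (1 + h) (doubling h 1 2 refl)
... | inj₁ mid = decomposition cut-sq₀↓
  (split (unfold-sq f ρ π p (1 + (h + h)) mid)
    (member p refl) (member _ rest) (member p (before p h))
    (member _ rest) (member p (before p h)) (member _ rest))
  where rest = beyond p (doubling h 1 2 refl)
... | inj₂ mid = decomposition cut-sq₀↑
  (split (unfold-sq f ρ π p (1 + (h + h)) mid)
    (member p refl) (member _ rest) (member p (before p (1 + h)))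
    (member _ rest) (member p (before p (1 + h))) (member _ rest))
  where rest = beyond p (doubling h 2 1 refl)
decompose {h} {sq₊} (member p refl) f ρ π = decomposition cut-sq₊
  (split (unfold-sq f ρ π p (2 + (h + h)) (mid-even _ p (2 + h) (doubling h 2 2 refl)))
    (member p refl) (member _ rest) (member p (before p (1 + h)))
    (member _ rest) (member p (before p (1 + h))) (member _ rest))
  where rest = beyond p (doubling h 2 2 refl)
decompose {h} {sle₋ w} (member p refl) f ρ π = decomposition (cut-sle₋ w)
  (split (unfold-sle f ρ π p (h + h) w (mid-even true p (1 + h) (doubling h 1 1 refl)))
    (member p refl) (member _ rest) (member p (before p h))
    (member _ rest) (member p (before p h)) (member _ rest))
  where rest = beyond p (doubling h 1 1 refl)
decompose {h} {sle₀ w} (member p refl) f ρ π = decomposition (cut-sle₀ w)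
  (split (unfold-sle f ρ π p (1 + (h + h)) w (mid-odd-up p (1 + h) (doubling h 1 2 refl)))
    (member p refl) (member _ rest) (member p (before p (1 + h)))
    (member _ rest) (member p (before p (1 + h))) (member _ rest))
  where rest = beyond p (doubling h 2 1 refl)
decompose {h} {sle₊ w} (member p refl) f ρ π = decomposition (cut-sle₊ w)
  (split (unfold-sle f ρ π p (2 + (h + h)) w (mid-even true p (2 + h) (doubling h 2 2 refl)))
    (member p refl) (member _ rest) (member p (before p (1 + h)))
    (member _ rest) (member p (before p (1 + h))) (member _ rest))
  where rest = beyond p (doubling h 2 2 refl)
decompose {h} {sls₋ v} (member p refl) f ρ π = decomposition (cut-sls₋ v)
  (split (unfold-sls f ρ π p (h + h) v (mid-odd-up p (1 + h) (doubling h 1 2 refl)))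
    (member p refl) (member _ rest) (member p (before p (1 + h)))
    (member _ rest) (member p (before p (1 + h))) (member _ rest))
  where rest = beyond p (doubling h 2 1 refl)
decompose {h} {sls₀ v} (member p refl) f ρ π = decomposition (cut-sls₀ v)
  (split (unfold-sls f ρ π p (1 + (h + h)) v (mid-even true p (2 + h) (doubling h 2 2 refl)))
    (member p refl) (member _ rest) (member p (before p (1 + h)))
    (member _ rest) (member p (before p (1 + h))) (member _ rest))
  where rest = beyond p (doubling h 2 2 refl)
decompose {h} {sls₊ v} (member p refl) f ρ π = decomposition (cut-sls₊ v)
  (split (unfold-sls f ρ π p (2 + (h + h)) v (mid-odd-up p (2 + h) (doubling h 2 3 refl)))
    (member p refl) (member _ rest) (member p (before p (2 + h)))
    (member _ rest) (member p (before p (2 + h))) (member _ rest))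
  where rest = beyond p (doubling h 3 2 refl)
decompose {h} {dip₋ v w} (member p refl) f ρ π = decomposition (cut-dip₋ v w)
  (split (unfold-dip f ρ π p (h + h) v w
           (trans (cong (half _) (plus-one p _)) (mid-even _ p (2 + h) (doubling h 2 2 refl))))
    (member p refl) (member _ rest) (member p (before p (1 + h)))
    (member _ rest) (member p (before p (1 + h))) (member _ rest))
  where rest = beyond p (doubling h 2 1 refl)
decompose {h} {dip₀ v w} (member p refl) f ρ π
  with mid-odd (ρ π (side v p) (side w (p + (2 + double h)))) p (2 + h) (doubling h 2 3 refl)
... | inj₁ mid = decomposition (cut-dip₀↓ v w)
  (split (unfold-dip f ρ π p (1 + (h + h)) v w (trans (cong (half _) (plus-one p _)) mid))
    (member p refl) (member _ rest) (member p (before p (1 + h)))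
    (member _ rest) (member p (before p (1 + h))) (member _ rest))
  where rest = beyond p (doubling h 2 2 refl)
... | inj₂ mid = decomposition (cut-dip₀↑ v w)
  (split (unfold-dip f ρ π p (1 + (h + h)) v w (trans (cong (half _) (plus-one p _)) mid))
    (member p refl) (member _ rest) (member p (before p (2 + h)))
    (member _ rest) (member p (before p (2 + h))) (member _ rest))
  where rest = beyond p (doubling h 3 1 refl)

-- The shift by 280 keeps κ natural.
record Count (h P Q κ : ℕ) (x y : Vertex) : Set where
  constructor count
  field
    run : ∀ f → h + 3 < f → ∀ ρ π → 135 * lits (vda f ρ π x y) + 54 + 280 * Q ≡ P + κ * Q
open Count

Level : (h P Q : ℕ) → (Tag → ℕ) → Set
Level h P Q κ = ∀ {t x y} → Member h t x y → Count h P Q (κ t) x y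

Recurrence : (Tag → ℕ) → (Tag → ℕ) → Set
Recurrence κ κ′ = ∀ {t t₀ t₁ t₂ t₃ t₄ t₅} → Rule t t₀ t₁ t₂ t₃ t₄ t₅ →
  κ t₀ + κ t₁ + κ t₂ + κ t₃ + κ t₄ + κ t₅ ≡ 840 + 3 * κ′ t

fuel-down : ∀ h f → double h + 3 < suc f → h + 3 < f
fuel-down h f fuel = <-≤-trans (+-monoˡ-< 3 h<double) (≤-pred fuel)
  where
  h<double : h < double h
  h<double = s≤s (≤-trans (m≤m+n h h) (n≤1+n (h + h)))

-- The invariant is inherited along a split whose coefficients obey the
-- recurrence: the split expression has ℓ₀ + … + ℓ₅ + 2 literals, so P and Q
-- scale by 6 and 3.
split-count : ∀ {h P Q κ t₀ t₁ t₂ t₃ t₄ t₅ f ρ π x y} K → Level h P Q κ →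
  Split h t₀ t₁ t₂ t₃ t₄ t₅ f ρ π x y → h + 3 < f →
  κ t₀ + κ t₁ + κ t₂ + κ t₃ + κ t₄ + κ t₅ ≡ 840 + 3 * K →
  135 * lits (vda (suc f) ρ π x y) + 54 + 280 * (3 * Q) ≡ 6 * P + K * (3 * Q)
split-count {h} {P} {Q} {κ} {t₀} {t₁} {t₂} {t₃} {t₄} {t₅} {f} {ρ} {π} {x} {y}
            K level (split {i} unfolds m₀ m₁ m₂ m₃ m₄ m₅) fuel recurrence =
  +-cancelʳ-≡ (840 * Q) _ _ (begin
    135 * lits (vda (suc f) ρ π x y) + 54 + 280 * (3 * Q) + 840 * Q
      ≡⟨ cong (λ expr → 135 * lits expr + 54 + 280 * (3 * Q) + 840 * Q) unfolds ⟩
    135 * ((ℓ₀ + ℓ₁) + ((ℓ₂ + 1) + ℓ₃) + ((ℓ₄ + 1) + ℓ₅)) + 54 + 280 * (3 * Q) + 840 * Q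
      ≡⟨ regroup ℓ₀ ℓ₁ ℓ₂ ℓ₃ ℓ₄ ℓ₅ Q ⟩
    (135 * ℓ₀ + 54 + 280 * Q) + (135 * ℓ₁ + 54 + 280 * Q) + (135 * ℓ₂ + 54 + 280 * Q)
      + (135 * ℓ₃ + 54 + 280 * Q) + (135 * ℓ₄ + 54 + 280 * Q) + (135 * ℓ₅ + 54 + 280 * Q)
      ≡⟨ cong₂ _+_ (cong₂ _+_ (cong₂ _+_ (cong₂ _+_ (cong₂ _+_ (piece m₀ 0) (piece m₁ 1))
                   (piece m₂ 2)) (piece m₃ 3)) (piece m₄ 4)) (piece m₅ 5) ⟩
    (P + κ t₀ * Q) + (P + κ t₁ * Q) + (P + κ t₂ * Q)
      + (P + κ t₃ * Q) + (P + κ t₄ * Q) + (P + κ t₅ * Q)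
      ≡⟨ collect P Q (κ t₀) (κ t₁) (κ t₂) (κ t₃) (κ t₄) (κ t₅) ⟩
    6 * P + (κ t₀ + κ t₁ + κ t₂ + κ t₃ + κ t₄ + κ t₅) * Q
      ≡⟨ cong (λ γ → 6 * P + γ * Q) {y = 840 + 3 * K} recurrence ⟩
    6 * P + (840 + 3 * K) * Q
      ≡⟨ spread P Q K ⟩
    6 * P + K * (3 * Q) + 840 * Q ∎)
  where
  ℓ₀ ℓ₁ ℓ₂ ℓ₃ ℓ₄ ℓ₅ : ℕ
  ℓ₀ = lits (vda f ρ (0 ∷ π) x (bas i))
  ℓ₁ = lits (vda f ρ (1 ∷ π) (bas i) y)
  ℓ₂ = lits (vda f ρ (2 ∷ π) x (up (i ∸ 1)))
  ℓ₃ = lits (vda f ρ (3 ∷ π) (up i) y)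
  ℓ₄ = lits (vda f ρ (4 ∷ π) x (lo (i ∸ 1)))
  ℓ₅ = lits (vda f ρ (5 ∷ π) (lo i) y)
  piece : ∀ {t x′ y′} → Member h t x′ y′ → ∀ j →
    135 * lits (vda f ρ (j ∷ π) x′ y′) + 54 + 280 * Q ≡ P + κ t * Q
  piece m j = run (level m) f fuel ρ (j ∷ π)
  regroup : ∀ ℓ₀ ℓ₁ ℓ₂ ℓ₃ ℓ₄ ℓ₅ Q →
    135 * ((ℓ₀ + ℓ₁) + ((ℓ₂ + 1) + ℓ₃) + ((ℓ₄ + 1) + ℓ₅)) + 54 + 280 * (3 * Q) + 840 * Q
      ≡ (135 * ℓ₀ + 54 + 280 * Q) + (135 * ℓ₁ + 54 + 280 * Q) + (135 * ℓ₂ + 54 + 280 * Q)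
        + (135 * ℓ₃ + 54 + 280 * Q) + (135 * ℓ₄ + 54 + 280 * Q) + (135 * ℓ₅ + 54 + 280 * Q)
  regroup = solve-∀
  collect : ∀ P Q c₀ c₁ c₂ c₃ c₄ c₅ →
    (P + c₀ * Q) + (P + c₁ * Q) + (P + c₂ * Q) + (P + c₃ * Q) + (P + c₄ * Q) + (P + c₅ * Q)
      ≡ 6 * P + (c₀ + c₁ + c₂ + c₃ + c₄ + c₅) * Q
  collect = solve-∀
  spread : ∀ P Q K → 6 * P + (840 + 3 * K) * Q ≡ 6 * P + K * (3 * Q) + 840 * Q
  spread = solve-∀

step : ∀ {h P Q κ κ′} → Level h P Q κ → Recurrence κ κ′ → Level (double h) (6 * P) (3 * Q) κ′
step {h} {κ′ = κ′} level recurrence {t} m = count λ where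
  zero    ()   ρ π
  (suc f) fuel ρ π → let open Decomposition (decompose {h} m f ρ π) in
    split-count (κ′ t) level parts (fuel-down h f fuel) (recurrence rule)

dip-count₋ dip-count₀ : Side → Side → ℕ
dip-count₋ U U = 3
dip-count₋ L L = 3
dip-count₋ U L = 2
dip-count₋ L U = 2
dip-count₀ U U = 11
dip-count₀ L L = 11
dip-count₀ U L = 12
dip-count₀ L U = 12

lits₀ : Tag → ℕ
lits₀ sq₀        = 5
lits₀ sq₊        = 16
lits₀ (sle₋ _)   = 1
lits₀ (sle₀ _)   = 8
lits₀ (sle₊ _)   = 22
lits₀ (sls₋ _)   = 1
lits₀ (sls₀ _)   = 8
lits₀ (sls₊ _)   = 22
lits₀ (dip₋ v w) = dip-count₋ v w
lits₀ (dip₀ v w) = dip-count₀ v w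

-- The classes at n = 2 whose expressions are given outright by rules 2–18.
data Base : Tag → Set where
  sq₀  : Base sq₀
  sle₋ : ∀ w → Base (sle₋ w)
  sle₀ : ∀ w → Base (sle₀ w)
  sls₋ : ∀ v → Base (sls₋ v)
  sls₀ : ∀ v → Base (sls₀ v)
  dip₋ : ∀ v w → Base (dip₋ v w)
  dip₀ : ∀ v w → Base (dip₀ v w)

base-count : ∀ {t x y} → Base t → Member 0 t x y →
  ∀ f ρ π → lits (vda (suc f) ρ π x y) ≡ lits₀ t
base-count sq₀ (member p refl) f ρ π rewrite m+n∸m≡n p 1 = refl
base-count (sle₋ U) (member p refl) f ρ π rewrite m+n∸m≡n p 0 = refl
base-count (sle₋ L) (member p refl) f ρ π rewrite m+n∸m≡n p 0 = refl
base-count (sle₀ U) (member p refl) f ρ π rewrite m+n∸m≡n p 1 = refl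
base-count (sle₀ L) (member p refl) f ρ π rewrite m+n∸m≡n p 1 = refl
base-count (sls₋ U) (member p refl) f ρ π rewrite m+n∸m≡n p 1 = refl
base-count (sls₋ L) (member p refl) f ρ π rewrite m+n∸m≡n p 1 = refl
base-count (sls₀ U) (member p refl) f ρ π rewrite m+n∸m≡n p 2 = refl
base-count (sls₀ L) (member p refl) f ρ π rewrite m+n∸m≡n p 2 = refl
base-count (dip₋ U U) (member p refl) f ρ π rewrite m+n∸m≡n p 1 = refl
base-count (dip₋ U L) (member p refl) f ρ π rewrite m+n∸m≡n p 1 = refl
base-count (dip₋ L U) (member p refl) f ρ π rewrite m+n∸m≡n p 1 = refl
base-count (dip₋ L L) (member p refl) f ρ π rewrite m+n∸m≡n p 1 = refl
base-count (dip₀ U U) (member p refl) f ρ π rewrite m+n∸m≡n p 2 = refl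
base-count (dip₀ U L) (member p refl) f ρ π rewrite m+n∸m≡n p 2 = refl
base-count (dip₀ L U) (member p refl) f ρ π rewrite m+n∸m≡n p 2 = refl
base-count (dip₀ L L) (member p refl) f ρ π rewrite m+n∸m≡n p 2 = refl

-- At n = 2 the classes of size 3 are split once more, into pieces given
-- outright by rules 2–18.
exact-split : ∀ {t₀ t₁ t₂ t₃ t₄ t₅ f ρ π x y} → Split 0 t₀ t₁ t₂ t₃ t₄ t₅ (suc f) ρ π x y →
  Base t₀ → Base t₁ → Base t₂ → Base t₃ → Base t₄ → Base t₅ →
  lits (vda (2 + f) ρ π x y)
    ≡ (lits₀ t₀ + lits₀ t₁) + ((lits₀ t₂ + 1) + lits₀ t₃) + ((lits₀ t₄ + 1) + lits₀ t₅)
exact-split {f = f} {ρ} {π} (split unfolds m₀ m₁ m₂ m₃ m₄ m₅) β₀ β₁ β₂ β₃ β₄ β₅ =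
  trans (cong lits unfolds)
    (cong₂ _+_ (cong₂ _+_ (cong₂ _+_ (piece-count β₀ m₀ 0) (piece-count β₁ m₁ 1))
                          (cong₂ _+_ (cong (_+ 1) (piece-count β₂ m₂ 2)) (piece-count β₃ m₃ 3)))
               (cong₂ _+_ (cong (_+ 1) (piece-count β₄ m₄ 4)) (piece-count β₅ m₅ 5)))
  where
  piece-count : ∀ {t x′ y′} → Base t → Member 0 t x′ y′ → ∀ j →
    lits (vda (suc f) ρ (j ∷ π) x′ y′) ≡ lits₀ t
  piece-count base m j = base-count base m f ρ (j ∷ π)

exact₀ : ∀ {t x y} → Member 0 t x y → ∀ f ρ π → lits (vda (2 + f) ρ π x y) ≡ lits₀ t
exact₀ {sq₀}      m f ρ π = base-count sq₀ m (suc f) ρ π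
exact₀ {sle₋ w}   m f ρ π = base-count (sle₋ w) m (suc f) ρ π
exact₀ {sle₀ w}   m f ρ π = base-count (sle₀ w) m (suc f) ρ π
exact₀ {sls₋ v}   m f ρ π = base-count (sls₋ v) m (suc f) ρ π
exact₀ {sls₀ v}   m f ρ π = base-count (sls₀ v) m (suc f) ρ π
exact₀ {dip₋ v w} m f ρ π = base-count (dip₋ v w) m (suc f) ρ π
exact₀ {dip₀ v w} m f ρ π = base-count (dip₀ v w) m (suc f) ρ π
exact₀ {sq₊} (member p refl) f ρ π = exact-split
  (split (unfold-sq (suc f) ρ π p 0 (mid-even _ p 1 refl))
    (member p refl) (member _ rest) (member p (before p 0))
    (member _ rest) (member p (before p 0)) (member _ rest))
  sq₀ sq₀ (sle₋ U) (sls₋ U) (sle₋ L) (sls₋ L)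
  where rest = beyond p {1} {1} refl
exact₀ {sle₊ w} (member p refl) f ρ π = trans (exact-split
  (split (unfold-sle (suc f) ρ π p 0 w (mid-even true p 1 refl))
    (member p refl) (member _ rest) (member p (before p 0))
    (member _ rest) (member p (before p 0)) (member _ rest))
  sq₀ (sle₀ w) (sle₋ U) (dip₋ U w) (sle₋ L) (dip₋ L w)) (tally w)
  where
  rest = beyond p {1} {1} refl
  tally : ∀ w → 5 + 8 + ((1 + 1) + dip-count₋ U w) + ((1 + 1) + dip-count₋ L w) ≡ 22
  tally U = refl
  tally L = refl
exact₀ {sls₊ v} (member p refl) f ρ π = trans (exact-split
  (split (unfold-sls (suc f) ρ π p 0 v (mid-odd-up p 1 refl))
    (member p refl) (member _ rest) (member p (before p 1))
    (member _ rest) (member p (before p 1)) (member _ rest))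
  (sls₀ v) sq₀ (dip₋ v U) (sls₋ U) (dip₋ v L) (sls₋ L)) (tally v)
  where
  rest = beyond p {2} {1} refl
  tally : ∀ v → 8 + 5 + ((dip-count₋ v U + 1) + 1) + ((dip-count₋ v L + 1) + 1) ≡ 22
  tally U = refl
  tally L = refl

-- The coefficients at n = 2 (k = 1, P = 924, Q = 3).
c₀ : Tag → ℕ
c₀ t = 45 * lits₀ t ∸ 10

calibration : ∀ t → 135 * lits₀ t + 54 + 280 * 3 ≡ 924 + c₀ t * 3
calibration sq₀        = refl
calibration sq₊        = refl
calibration (sle₋ _)   = refl
calibration (sle₀ _)   = refl
calibration (sle₊ _)   = refl
calibration (sls₋ _)   = refl
calibration (sls₀ _)   = refl
calibration (sls₊ _)   = refl
calibration (dip₋ U U) = refl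
calibration (dip₋ U L) = refl
calibration (dip₋ L U) = refl
calibration (dip₋ L L) = refl
calibration (dip₀ U U) = refl
calibration (dip₀ U L) = refl
calibration (dip₀ L U) = refl
calibration (dip₀ L L) = refl

level₀ : Level 0 924 3 c₀
level₀ {t} m = count λ where
  zero          ()       ρ π
  (suc zero)    (s≤s ()) ρ π
  (suc (suc f)) _        ρ π →
    trans (cong (λ ℓ → 135 * ℓ + 54 + 280 * 3) (exact₀ m f ρ π)) (calibration t)

-- The coefficients for every n = 2^k with k ≥ 2: a fixed point of the
-- recurrence.  After the shift by 280 they are 5, 95, 290 for the classes of
-- size exactly n, as in the theorem.
coeff : Tag → ℕ
coeff sq₀        = 285
coeff sq₊        = 660
coeff (sle₋ _)   = 0
coeff (sle₀ _)   = 375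
coeff (sle₊ _)   = 855
coeff (sls₋ _)   = 0
coeff (sls₀ _)   = 375
coeff (sls₊ _)   = 855
coeff (dip₋ _ _) = 90
coeff (dip₀ _ _) = 570

recurrence₀ : Recurrence c₀ coeff
recurrence₀ cut-sq₀↓ = refl
recurrence₀ cut-sq₀↑ = refl
recurrence₀ cut-sq₊  = refl
recurrence₀ (cut-sle₋ U) = refl
recurrence₀ (cut-sle₋ L) = refl
recurrence₀ (cut-sle₀ U) = refl
recurrence₀ (cut-sle₀ L) = refl
recurrence₀ (cut-sle₊ U) = refl
recurrence₀ (cut-sle₊ L) = refl
recurrence₀ (cut-sls₋ U) = refl
recurrence₀ (cut-sls₋ L) = refl
recurrence₀ (cut-sls₀ U) = refl
recurrence₀ (cut-sls₀ L) = refl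
recurrence₀ (cut-sls₊ U) = refl
recurrence₀ (cut-sls₊ L) = refl
recurrence₀ (cut-dip₋ U U) = refl
recurrence₀ (cut-dip₋ U L) = refl
recurrence₀ (cut-dip₋ L U) = refl
recurrence₀ (cut-dip₋ L L) = refl
recurrence₀ (cut-dip₀↓ U U) = refl
recurrence₀ (cut-dip₀↓ U L) = refl
recurrence₀ (cut-dip₀↓ L U) = refl
recurrence₀ (cut-dip₀↓ L L) = refl
recurrence₀ (cut-dip₀↑ U U) = refl
recurrence₀ (cut-dip₀↑ U L) = refl
recurrence₀ (cut-dip₀↑ L U) = refl
recurrence₀ (cut-dip₀↑ L L) = refl

recurrence : Recurrence coeff coeff
recurrence cut-sq₀↓ = refl
recurrence cut-sq₀↑ = refl
recurrence cut-sq₊  = refl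
recurrence (cut-sle₋ _) = refl
recurrence (cut-sle₀ _) = refl
recurrence (cut-sle₊ _) = refl
recurrence (cut-sls₋ _) = refl
recurrence (cut-sls₀ _) = refl
recurrence (cut-sls₊ _) = refl
recurrence (cut-dip₋ _ _) = refl
recurrence (cut-dip₀↓ _ _) = refl
recurrence (cut-dip₀↑ _ _) = refl

scale : ℕ → ℕ
scale zero    = 2
scale (suc j) = double (scale j)

scale-size : ∀ j → 2 ^ (2 + j) ≡ 2 + scale j
scale-size zero    = refl
scale-size (suc j) = trans (cong (2 *_) (scale-size j)) (twice (scale j))
  where
  twice : ∀ h → 2 * (2 + h) ≡ 2 + (2 + (h + h))
  twice = solve-∀

level-cast : ∀ {h P P′ Q Q′ κ} → P ≡ P′ → Q ≡ Q′ → Level h P Q κ → Level h P′ Q′ κ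
level-cast refl refl level = level

level : ∀ j → Level (scale j) (154 * 6 ^ (2 + j)) (3 ^ (2 + j)) coeff
level zero    = step {κ′ = coeff} level₀ recurrence₀
level (suc j) =
  level-cast (reassociate (6 ^ (2 + j))) refl (step {κ′ = coeff} (level j) recurrence)
  where
  reassociate : ∀ m → 6 * (154 * m) ≡ 154 * (6 * m)
  reassociate = solve-∀

literals : ∀ {h P Q κ t x y} γ → Level h P Q κ → Member h t x y → 1 ≤ gap t →
  κ t ≡ γ + 280 → ∀ ρ → 135 * lits (VDA ρ x y) + 54 ≡ P + γ * Q
literals {P = P} {Q} {κ} {t} {x} {y} γ level m positive shifted ρ =
  +-cancelʳ-≡ (280 * Q) _ _ (begin
    135 * lits (VDA ρ x y) + 54 + 280 * Q
      ≡⟨ run (level m) (idx y + 3) (+-monoˡ-< 3 (member-reach m positive)) ρ [] ⟩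
    P + κ t * Q
      ≡⟨ cong (λ k → P + k * Q) shifted ⟩
    P + (γ + 280) * Q
      ≡⟨ unshift P Q γ ⟩
    P + γ * Q + 280 * Q ∎)
  where
  unshift : ∀ P Q γ → P + (γ + 280) * Q ≡ P + γ * Q + 280 * Q
  unshift = solve-∀

mainTheorem3 : (k : ℕ) → 2 ≤ k →
    ((ρ : Oracle) →
      135 * lits (VDA ρ (bas 1) (bas (2 ^ k))) + 54 ≡ 154 * 6 ^ k + 5 * 3 ^ k)
    × ((ρ : Oracle) (x y : Vertex) → SingleLeaf (2 ^ k) x y →
      135 * lits (VDA ρ x y) + 54 ≡ 154 * 6 ^ k + 95 * 3 ^ k)
    × ((ρ : Oracle) (x y : Vertex) → Dipterous (2 ^ k) x y →
      135 * lits (VDA ρ x y) + 54 ≡ 154 * 6 ^ k + 290 * 3 ^ k)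
mainTheorem3 zero          ()
mainTheorem3 (suc zero)    (s≤s ())
mainTheorem3 (suc (suc j)) _ = square , single-leaf , dipterous
  where
  n = 2 ^ (2 + j)
  h = scale j
  size : n ≡ 2 + h
  size = scale-size j
  read : ∀ t {x y} γ → Member h t x y → 1 ≤ gap t → coeff t ≡ γ + 280 → ∀ ρ →
    135 * lits (VDA ρ x y) + 54 ≡ 154 * 6 ^ (2 + j) + γ * 3 ^ (2 + j)
  read t γ = literals γ (level j)
  leaf-end : ∀ p → p + n ∸ 1 ≡ p + (1 + h)
  leaf-end p = trans (cong (λ m → p + m ∸ 1) size) (before p (1 + h))
  square : (ρ : Oracle) → 135 * lits (VDA ρ (bas 1) (bas n)) + 54 ≡ 154 * 6 ^ (2 + j) + 5 * 3 ^ (2 + j)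
  square = read sq₀ 5 (member 1 size) (s≤s z≤n) refl
  single-leaf : (ρ : Oracle) (x y : Vertex) → SingleLeaf n x y →
    135 * lits (VDA ρ x y) + 54 ≡ 154 * 6 ^ (2 + j) + 95 * 3 ^ (2 + j)
  single-leaf ρ _ _ (bas→up p _) = read (sle₀ U) 95 (member p (leaf-end p)) (s≤s z≤n) refl ρ
  single-leaf ρ _ _ (bas→lo p _) = read (sle₀ L) 95 (member p (leaf-end p)) (s≤s z≤n) refl ρ
  single-leaf ρ _ _ (up→bas p _) = read (sls₀ U) 95 (member p (cong (p +_) size)) (s≤s z≤n) refl ρ
  single-leaf ρ _ _ (lo→bas p _) = read (sls₀ L) 95 (member p (cong (p +_) size)) (s≤s z≤n) refl ρ
  dipterous : (ρ : Oracle) (x y : Vertex) → Dipterous n x y →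
    135 * lits (VDA ρ x y) + 54 ≡ 154 * 6 ^ (2 + j) + 290 * 3 ^ (2 + j)
  dipterous ρ _ _ (up→up p _) = read (dip₀ U U) 290 (member p (cong (p +_) size)) (s≤s z≤n) refl ρ
  dipterous ρ _ _ (lo→lo p _) = read (dip₀ L L) 290 (member p (cong (p +_) size)) (s≤s z≤n) refl ρ
  dipterous ρ _ _ (up→lo p _) = read (dip₀ U L) 290 (member p (cong (p +_) size)) (s≤s z≤n) refl ρ
  dipterous ρ _ _ (lo→up p _) = read (dip₀ L U) 290 (member p (cong (p +_) size)) (s≤s z≤n) refl ρ
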